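{- For $M\in\Lambda$, the following are equivalent: (1) $M$ is potentially valuable; (2) $\mathrm{BT}(M)\neq\emptyset$, i.e. $\mathcal A(M)\neq\emptyset$.
   Context: Call-by-value $\lambda$-calculus: $\Lambda$ is the set of $\lambda$-terms $M::=x\mid\lambda x.M\mid MN$ up to $\alpha$-conversion; values are variables and abstractions. Reductions: $(\beta_v)$ $(\lambda x.M)V\to M\{V/x\}$ for $V$ a value; $(\sigma_1)$ $(\lambda x.M)NP\to(\lambda x.MP)N$ if $x\notin FV(P)$; $(\sigma_3)$ $V((\lambda x.M)N)\to(\lambda x.VM)N$ if $V$ value, $x\notin FV(V)$. $\to_{\mathsf v}$ is the contextual closure of their union, $\twoheadrightarrow_{\mathsf v}$ and $\twoheadrightarrow_{\beta_v}$ reflexive-transitive closures of $\to_{\mathsf v}$ and of the contextual closure of $(\beta_v)$. $M$ is valuable if $M\twoheadrightarrow_{\beta_v}V$ for some value $V$; $M$ is potentially valuable if, with $FV(M)=\{x_1,\dots,x_n\}$, there are values $V_1,\dots,V_n$ such that $(\lambda x_1\dots x_n.M)V_1\cdots V_n$ is valuable. $\Lambda_\bot$: $\lambda$-terms possibly containing a constant $\bot$; $\sqsubseteq$ is the context-closed preorder generated by $\bot\sqsubseteq x$, $\bot\sqsubseteq\lambda x.M$. Approximants $\mathcal A$: $A::=B\mid C$; $B::=x\mid\lambda x.A\mid\bot\mid xBA_1\cdots A_k$; $C::=(\lambda x.A)(yBA_1\cdots A_k)$ ($k\ge0$). $\mathcal A(M)=\{A\in\mathcal A\mid\exists N,\ M\twoheadrightarrow_{\mathsf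 v}N,\ A\sqsubseteq N\}$; $\mathrm{BT}(M)=\bigsqcup\mathcal A(M)$ with the convention $\bigsqcup\emptyset=\emptyset$ (so $\mathrm{BT}(M)=\emptyset$ iff $\mathcal A(M)=\emptyset$, while e.g. $\mathrm{BT}(\lambda x.\Omega)=\bot$). -}

module Defs where

open import Data.Nat using (ℕ; zero; suc)
open import Data.Fin using (Fin; zero; suc)
open import Data.Product using (Σ; ∃; _×_; _,_)
open import Relation.Binary.Construct.Closure.ReflexiveTransitive using (Star)

-- Pure λ-terms Λ, well-scoped de Bruijn (α-conversion is built in).
-- Λ n = terms whose free variables are among the n variables in scope.

data Λ (n : ℕ) : Set where
  var : Fin n → Λ n
  lam : Λ (suc n) → Λ n
  app : Λ n → Λ n → Λ n

data Value {n : ℕ} : Λ n → Set where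
  var : (i : Fin n) → Value (var i)
  lam : (M : Λ (suc n)) → Value (lam M)

data _∈FV_ {n : ℕ} : Fin n → Λ n → Set where
  var  : (i : Fin n) → i ∈FV var i
  lam  : {i : Fin n} {M : Λ (suc n)} → suc i ∈FV M → i ∈FV lam M
  appˡ : {i : Fin n} {M N : Λ n} → i ∈FV M → i ∈FV app M N
  appʳ : {i : Fin n} {M N : Λ n} → i ∈FV N → i ∈FV app M N

ext : {n m : ℕ} → (Fin n → Fin m) → Fin (suc n) → Fin (suc m)
ext ρ zero    = zero
ext ρ (suc i) = suc (ρ i)

rename : {n m : ℕ} → (Fin n → Fin m) → Λ n → Λ m
rename ρ (var i)   = var (ρ i)
rename ρ (lam M)   = lam (rename (ext ρ) M)
rename ρ (app M N) = app (rename ρ M) (rename ρ N)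

weaken : {n : ℕ} → Λ n → Λ (suc n)
weaken = rename suc

exts : {n m : ℕ} → (Fin n → Λ m) → Fin (suc n) → Λ (suc m)
exts σ zero    = var zero
exts σ (suc i) = weaken (σ i)

subst : {n m : ℕ} → (Fin n → Λ m) → Λ n → Λ m
subst σ (var i)   = σ i
subst σ (lam M)   = lam (subst (exts σ) M)
subst σ (app M N) = app (subst σ M) (subst σ N)

-- M{N/x} where x is the variable bound by the outermost λ (index zero)
_[_] : {n : ℕ} → Λ (suc n) → Λ n → Λ n
M [ N ] = subst σ M
  where
  σ : Fin _ → Λ _
  σ zero    = N
  σ (suc i) = var i

data _⟶βv_ {n : ℕ} : Λ n → Λ n → Set where
  βv : (M : Λ (suc n)) (V : Λ n) → Value V → app (lam M) V ⟶βv (M [ V ])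

-- (β_v), (σ_1), (σ_3).  The side conditions x ∉ FV(P), x ∉ FV(V) are
-- built in by weakening P (resp. V) under the binder.
data _⟶root_ {n : ℕ} : Λ n → Λ n → Set where
  βv : {M N : Λ n} → M ⟶βv N → M ⟶root N
  σ₁ : (M : Λ (suc n)) (N P : Λ n) →
       app (app (lam M) N) P ⟶root app (lam (app M (weaken P))) N
  σ₃ : (V : Λ n) (M : Λ (suc n)) (N : Λ n) → Value V →
       app V (app (lam M) N) ⟶root app (lam (app (weaken V) M)) N

data Ctx (R : {n : ℕ} → Λ n → Λ n → Set) {n : ℕ} : Λ n → Λ n → Set where
  root : {M N : Λ n} → R M N → Ctx R M N
  lam  : {M N : Λ (suc n)} → Ctx R M N → Ctx R (lam M) (lam N)
  appˡ : {M N : Λ n} (P : Λ n) → Ctx R M N → Ctx R (app M P) (app N P)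
  appʳ : {M N : Λ n} (P : Λ n) → Ctx R M N → Ctx R (app P M) (app P N)

_→v_ : {n : ℕ} → Λ n → Λ n → Set
_→v_ = Ctx _⟶root_

_↠v_ : {n : ℕ} → Λ n → Λ n → Set
_↠v_ = Star _→v_

_↠βv_ : {n : ℕ} → Λ n → Λ n → Set
_↠βv_ = Star (Ctx _⟶βv_)

Valuable : {n : ℕ} → Λ n → Set
Valuable M = ∃ λ V → (M ↠βv V) × Value V

lams : {n : ℕ} → Λ n → Λ 0
lams {zero}  M = M
lams {suc n} M = lams {n} (lam M)

appSpine : {n m : ℕ} → Λ m → (Fin n → Λ m) → Λ m
appSpine {zero}  P V = P
appSpine {suc n} P V = appSpine {n} (app P (V zero)) (λ i → V (suc i))

closedTo : {m : ℕ} → Λ 0 → Λ m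
closedTo = rename (λ ())

-- M (with its free variables among the n in scope) is potentially valuable
-- iff there are values V₁,…,Vₙ (possibly open, in any scope m) such that
-- (λx₁…xₙ.M)V₁⋯Vₙ is valuable.
PotentiallyValuable : {n : ℕ} → Λ n → Set
PotentiallyValuable {n} M =
  Σ ℕ λ m → Σ (Fin n → Λ m) λ V →
    ((i : Fin n) → Value (V i)) × Valuable (appSpine (closedTo (lams M)) V)

data Λ⊥ (n : ℕ) : Set where
  var : Fin n → Λ⊥ n
  lam : Λ⊥ (suc n) → Λ⊥ n
  app : Λ⊥ n → Λ⊥ n → Λ⊥ n
  bot : Λ⊥ n

embed : {n : ℕ} → Λ n → Λ⊥ n
embed (var i)   = var i
embed (lam M)   = lam (embed M)
embed (app M N) = app (embed M) (embed N)

data _⊑_ {n : ℕ} : Λ⊥ n → Λ⊥ n → Set where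
  bot-var : (i : Fin n) → bot ⊑ var i
  bot-lam : (M : Λ⊥ (suc n)) → bot ⊑ lam M
  refl    : (M : Λ⊥ n) → M ⊑ M
  trans   : {M N P : Λ⊥ n} → M ⊑ N → N ⊑ P → M ⊑ P
  lam     : {M N : Λ⊥ (suc n)} → M ⊑ N → lam M ⊑ lam N
  app     : {M M' N N' : Λ⊥ n} → M ⊑ M' → N ⊑ N' → app M N ⊑ app M' N'

-- Approximants
--   A ::= B | C
--   B ::= x | λx.A | ⊥ | x B A₁ ⋯ Aₖ
--   C ::= (λx.A)(y B A₁ ⋯ Aₖ)          (k ≥ 0)

data IsA     {n : ℕ} : Λ⊥ n → Set
data IsB     {n : ℕ} : Λ⊥ n → Set
data IsHead  {n : ℕ} : Λ⊥ n → Set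
data IsC     {n : ℕ} : Λ⊥ n → Set

data IsHead {n} where
  base : (x : Fin n) {B : Λ⊥ n} → IsB B → IsHead (app (var x) B)
  more : {H A : Λ⊥ n} → IsHead H → IsA A → IsHead (app H A)

data IsB {n} where
  var  : (x : Fin n) → IsB (var x)
  lam  : {A : Λ⊥ (suc n)} → IsA A → IsB (lam A)
  bot  : IsB bot
  head : {H : Λ⊥ n} → IsHead H → IsB H

data IsC {n} where
  redex : {A : Λ⊥ (suc n)} {H : Λ⊥ n} → IsA A → IsHead H → IsC (app (lam A) H)

data IsA {n} where
  b : {M : Λ⊥ n} → IsB M → IsA M
  c : {M : Λ⊥ n} → IsC M → IsA M

_∈𝒜_ : {n : ℕ} → Λ⊥ n → Λ n → Set
A ∈𝒜 M = IsA A × ∃ λ N → (M ↠v N) × (A ⊑ embed N)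

𝒜-nonempty : {n : ℕ} → Λ n → Set
𝒜-nonempty M = ∃ λ A → A ∈𝒜 M

module Submission where

-- Both conditions amount to typability in the call-by-value system of non-idempotent
-- intersection types (multi types), where every value has the empty multi type.
-- Typings are preserved by βv- and σ-expansion, and by reduction, the size of a
-- derivation dropping at each βv-step and staying put at each σ-step.  Hence a typed
-- term v-reduces to a term shaped like an approximant, and a closed typed term
-- βv-reduces to a value.  If (λx⃗.M)V⃗ reaches a value, expanding a typing of that
-- value back to (λx⃗.M)V⃗ types M, and normalising M exhibits an approximant.
-- Conversely, if an approximant lies below a reduct N of M, substituting for every
-- free variable the term E, which swallows any value it is applied to, turns N into
-- a term that βv-reduces to a value; expanding types M{E⃗/x⃗}, which is closed and so
-- valuable, and (λx⃗.M)E⃗ βv-reduces to it.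

open import Defs hiding (trans)
open import Level using (0ℓ)
open import Algebra.Bundles using (Monoid; CommutativeMonoid)
import Algebra.Construct.Pointwise as Pointwise
import Algebra.Properties.Monoid.Sum as MonoidSum
import Algebra.Properties.CommutativeMonoid.Sum as CommutativeMonoidSum
import Algebra.Properties.CommutativeSemigroup as CommutativeSemigroupProperties
open import Data.Nat using (ℕ; zero; suc; _+_; _≤_; _<_; z≤n; s≤s)
open import Data.Fin using (Fin; zero; suc; _≟_)
open import Data.Nat.Properties
  using (+-commutativeSemigroup; +-0-commutativeMonoid; +-assoc; +-identityʳ; +-suc;
         +-mono-≤; m≤m+n; m≤n+m; ≤-refl; ≤-trans; <-≤-trans; <⇒≤)
open import Data.Fin.Properties using (suc-injective)
open import Data.List using (List; []; _∷_; _++_)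
open import Data.List.Relation.Binary.Permutation.Propositional as Perm
  using (_↭_; ↭-refl; ↭-sym; ↭-trans; prep; swap)
import Data.List.Relation.Binary.Permutation.Propositional.Properties as ↭
open import Data.Vec.Functional using (Vector; updateAt; tail)
open import Data.Vec.Functional.Properties using (updateAt-updates; updateAt-minimal)
open import Data.Product using (Σ; ∃-syntax; _×_; _,_; proj₁; proj₂)
open import Data.Sum using (_⊎_; inj₁; inj₂)
open import Data.Empty using (⊥-elim)
open import Function using (_∘_; const)
open import Function.Bundles using (_⇔_; mk⇔)
open import Relation.Nullary using (yes; no)
open import Relation.Binary.PropositionalEquality
  using (_≡_; _≢_; refl; sym; trans; cong; cong₂; module ≡-Reasoning)
  renaming (subst to ≡-subst)
open import Relation.Binary.Construct.Closure.ReflexiveTransitive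
  using (Star; ε; _◅_; _◅◅_; gmap)

variable
  n m k : ℕ

module _ {c ℓ} (𝕄 : Monoid c ℓ) where
  open Monoid 𝕄 using (Carrier; _≈_; ∙-congˡ; ∙-congʳ; identityˡ; identityʳ)
    renaming (trans to ≈-trans; ε to ε𝕄)
  open MonoidSum 𝕄 using (sum; sum-cong-≋; sum-replicate-zero)

  sum-supported : (t : Vector Carrier n) (x : Fin n) → (∀ j → j ≢ x → t j ≈ ε𝕄) → sum t ≈ t x
  sum-supported {suc n} t zero off =
    ≈-trans (∙-congˡ (≈-trans (sum-cong-≋ (λ j → off (suc j) λ ())) (sum-replicate-zero n))) (identityʳ _)
  sum-supported t (suc x) off =
    ≈-trans (∙-congʳ (off zero λ ()))
            (≈-trans (identityˡ _) (sum-supported (tail t) x λ j j≢x → off (suc j) (j≢x ∘ suc-injective)))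

module + = CommutativeSemigroupProperties +-commutativeSemigroup
open CommutativeMonoidSum +-0-commutativeMonoid using ()
  renaming (sum to ∑ℕ; sum-cong-≗ to ∑ℕ-cong; ∑-distrib-+ to ∑ℕ-distrib-+; sum-replicate-zero to ∑ℕ-0)

∑ℕ-≥ : (t : Fin n → ℕ) (x : Fin n) → t x ≤ ∑ℕ t
∑ℕ-≥ t zero    = m≤m+n (t zero) _
∑ℕ-≥ t (suc x) = ≤-trans (∑ℕ-≥ (t ∘ suc) x) (m≤n+m _ (t zero))

+-mono-≤-interchange : ∀ w y {x z v u₁ u₂} → v ≡ x + z → u₁ ≤ w + x → u₂ ≤ y + z →
                       u₁ + u₂ ≤ (w + y) + v
+-mono-≤-interchange w y {x} {z} {u₁ = u₁} {u₂} refl p q =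
  ≡-subst (u₁ + u₂ ≤_) (+.interchange w x y z) (+-mono-≤ p q)

-- Renaming and substitution

ext-cong : {ρ ρ′ : Fin n → Fin m} → (∀ i → ρ i ≡ ρ′ i) → ∀ i → ext ρ i ≡ ext ρ′ i
ext-cong h zero    = refl
ext-cong h (suc i) = cong suc (h i)

rename-cong : {ρ ρ′ : Fin n → Fin m} → (∀ i → ρ i ≡ ρ′ i) → ∀ M → rename ρ M ≡ rename ρ′ M
rename-cong h (var i)   = cong var (h i)
rename-cong h (lam M)   = cong lam (rename-cong (ext-cong h) M)
rename-cong h (app M N) = cong₂ app (rename-cong h M) (rename-cong h N)

exts-cong : {σ σ′ : Fin n → Λ m} → (∀ i → σ i ≡ σ′ i) → ∀ i → exts σ i ≡ exts σ′ i
exts-cong h zero    = refl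
exts-cong h (suc i) = cong weaken (h i)

subst-cong : {σ σ′ : Fin n → Λ m} → (∀ i → σ i ≡ σ′ i) → ∀ M → subst σ M ≡ subst σ′ M
subst-cong h (var i)   = h i
subst-cong h (lam M)   = cong lam (subst-cong (exts-cong h) M)
subst-cong h (app M N) = cong₂ app (subst-cong h M) (subst-cong h N)

rename-id : {ρ : Fin n → Fin n} → (∀ i → ρ i ≡ i) → ∀ M → rename ρ M ≡ M
rename-id h (var i)   = cong var (h i)
rename-id h (lam M)   = cong lam (rename-id (λ { zero → refl ; (suc i) → cong suc (h i) }) M)
rename-id h (app M N) = cong₂ app (rename-id h M) (rename-id h N)

subst-var : (M : Λ n) → subst var M ≡ M
subst-var (var i)   = refl
subst-var (lam M)   = cong lam (trans (subst-cong (λ { zero → refl ; (suc i) → refl }) M) (subst-var M))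
subst-var (app M N) = cong₂ app (subst-var M) (subst-var N)

rename-rename : (ρ : Fin m → Fin k) (ρ′ : Fin n → Fin m) (M : Λ n) →
                rename ρ (rename ρ′ M) ≡ rename (ρ ∘ ρ′) M
rename-rename ρ ρ′ (var i)   = refl
rename-rename ρ ρ′ (lam M)   =
  cong lam (trans (rename-rename (ext ρ) (ext ρ′) M) (rename-cong (λ { zero → refl ; (suc i) → refl }) M))
rename-rename ρ ρ′ (app M N) = cong₂ app (rename-rename ρ ρ′ M) (rename-rename ρ ρ′ N)

subst-rename : (σ : Fin m → Λ k) (ρ : Fin n → Fin m) (M : Λ n) →
               subst σ (rename ρ M) ≡ subst (σ ∘ ρ) M
subst-rename σ ρ (var i)   = refl
subst-rename σ ρ (lam M)   =
  cong lam (trans (subst-rename (exts σ) (ext ρ) M) (subst-cong (λ { zero → refl ; (suc i) → refl }) M))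
subst-rename σ ρ (app M N) = cong₂ app (subst-rename σ ρ M) (subst-rename σ ρ N)

rename-subst : (ρ : Fin m → Fin k) (σ : Fin n → Λ m) (M : Λ n) →
               rename ρ (subst σ M) ≡ subst (rename ρ ∘ σ) M
rename-subst ρ σ (var i)   = refl
rename-subst ρ σ (lam M)   = cong lam (trans (rename-subst (ext ρ) (exts σ) M) (subst-cong commute M))
  where
  commute : ∀ i → rename (ext ρ) (exts σ i) ≡ exts (rename ρ ∘ σ) i
  commute zero    = refl
  commute (suc i) = trans (rename-rename (ext ρ) suc (σ i)) (sym (rename-rename suc ρ (σ i)))
rename-subst ρ σ (app M N) = cong₂ app (rename-subst ρ σ M) (rename-subst ρ σ N)

subst-subst : (τ : Fin m → Λ k) (σ : Fin n → Λ m) (M : Λ n) →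
              subst τ (subst σ M) ≡ subst (subst τ ∘ σ) M
subst-subst τ σ (var i)   = refl
subst-subst τ σ (lam M)   = cong lam (trans (subst-subst (exts τ) (exts σ) M) (subst-cong commute M))
  where
  commute : ∀ i → subst (exts τ) (exts σ i) ≡ exts (subst τ ∘ σ) i
  commute zero    = refl
  commute (suc i) = trans (subst-rename (exts τ) suc (σ i)) (sym (rename-subst suc τ (σ i)))
subst-subst τ σ (app M N) = cong₂ app (subst-subst τ σ M) (subst-subst τ σ N)

subst-weaken : (σ : Fin n → Λ m) (M : Λ n) → subst (exts σ) (weaken M) ≡ weaken (subst σ M)
subst-weaken σ M = trans (subst-rename (exts σ) suc M) (sym (rename-subst suc σ M))

-- Defs._[_] substitutes with a where-bound function; sub₀ is that function.
sub₀ : Λ n → Fin (suc n) → Λ n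
sub₀ V zero    = V
sub₀ V (suc i) = var i

[]≡subst-sub₀ : (M : Λ (suc n)) (V : Λ n) → M [ V ] ≡ subst (sub₀ V) M
[]≡subst-sub₀ M V = subst-cong (λ { zero → refl ; (suc i) → refl }) M

subst-[] : (σ : Fin n → Λ m) (M : Λ (suc n)) (V : Λ n) →
           subst σ (M [ V ]) ≡ subst (exts σ) M [ subst σ V ]
subst-[] σ M V = begin
  subst σ (M [ V ])                              ≡⟨ cong (subst σ) ([]≡subst-sub₀ M V) ⟩
  subst σ (subst (sub₀ V) M)                     ≡⟨ subst-subst σ (sub₀ V) M ⟩
  subst (subst σ ∘ sub₀ V) M                     ≡⟨ subst-cong commute M ⟩
  subst (subst (sub₀ (subst σ V)) ∘ exts σ) M    ≡⟨ subst-subst _ (exts σ) M ⟨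
  subst (sub₀ (subst σ V)) (subst (exts σ) M)    ≡⟨ []≡subst-sub₀ (subst (exts σ) M) (subst σ V) ⟨
  subst (exts σ) M [ subst σ V ]                 ∎
  where
  open ≡-Reasoning
  commute : ∀ i → subst σ (sub₀ V i) ≡ subst (sub₀ (subst σ V)) (exts σ i)
  commute zero    = refl
  commute (suc i) = sym (trans (subst-rename _ suc (σ i)) (subst-var (σ i)))

Values : (Fin n → Λ m) → Set
Values σ = ∀ i → Value (σ i)

Value-rename : (ρ : Fin n → Fin m) {V : Λ n} → Value V → Value (rename ρ V)
Value-rename ρ (var i) = var (ρ i)
Value-rename ρ (lam M) = lam _

Value-subst : {σ : Fin n → Λ m} → Values σ → {V : Λ n} → Value V → Value (subst σ V)
Value-subst vσ (var i) = vσ i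
Value-subst vσ (lam M) = lam _

Values-exts : {σ : Fin n → Λ m} → Values σ → Values (exts σ)
Values-exts vσ zero    = var zero
Values-exts vσ (suc i) = Value-rename suc (vσ i)

exts-const-[] : (W : Λ m) (M : Λ (suc n)) → subst (exts (const W)) M [ W ] ≡ subst (const W) M
exts-const-[] W M = begin
  subst (exts (const W)) M [ W ]                 ≡⟨ []≡subst-sub₀ (subst (exts (const W)) M) W ⟩
  subst (sub₀ W) (subst (exts (const W)) M)      ≡⟨ subst-subst (sub₀ W) (exts (const W)) M ⟩
  subst (subst (sub₀ W) ∘ exts (const W)) M      ≡⟨ subst-cong (λ { zero → refl ; (suc i) → unweaken }) M ⟩
  subst (const W) M                              ∎
  where
  open ≡-Reasoning
  unweaken : subst (sub₀ W) (weaken W) ≡ W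
  unweaken = trans (subst-rename (sub₀ W) suc W) (subst-var W)

module _ {R : ∀ {n} → Λ n → Λ n → Set} where

  ↠-lam : {M N : Λ (suc n)} → Star (Ctx R) M N → Star (Ctx R) (lam M) (lam N)
  ↠-lam = gmap lam lam

  ↠-appˡ : (P : Λ n) {M N : Λ n} → Star (Ctx R) M N → Star (Ctx R) (app M P) (app N P)
  ↠-appˡ P = gmap (λ M → app M P) (appˡ P)

  ↠-appʳ : (P : Λ n) {M N : Λ n} → Star (Ctx R) M N → Star (Ctx R) (app P M) (app P N)
  ↠-appʳ P = gmap (app P) (appʳ P)

  ↠-app : {M M′ N N′ : Λ n} → Star (Ctx R) M M′ → Star (Ctx R) N N′ →
          Star (Ctx R) (app M N) (app M′ N′)
  ↠-app {M′ = M′} {N = N} r s = ↠-appˡ N r ◅◅ ↠-appʳ M′ s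

  ↠-reflexive : {M N : Λ n} → M ≡ N → Star (Ctx R) M N
  ↠-reflexive refl = ε

subst-→v : {σ : Fin n → Λ m} → Values σ → {M M′ : Λ n} → M →v M′ → subst σ M →v subst σ M′
subst-→v {σ = σ} vσ (root (βv (βv M V v))) rewrite subst-[] σ M V =
  root (βv (βv _ _ (Value-subst vσ v)))
subst-→v {σ = σ} vσ (root (σ₁ M N P)) rewrite subst-weaken σ P = root (σ₁ _ _ _)
subst-→v {σ = σ} vσ (root (σ₃ V M N v)) rewrite subst-weaken σ V =
  root (σ₃ _ _ _ (Value-subst vσ v))
subst-→v vσ (lam r)    = lam (subst-→v (Values-exts vσ) r)
subst-→v vσ (appˡ P r) = appˡ _ (subst-→v vσ r)
subst-→v vσ (appʳ P r) = appʳ _ (subst-→v vσ r)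

subst-↠v : {σ : Fin n → Λ m} → Values σ → {M M′ : Λ n} → M ↠v M′ → subst σ M ↠v subst σ M′
subst-↠v vσ = gmap _ (subst-→v vσ)

appSpine-const-snoc : (P W : Λ m) → appSpine {suc n} P (const W) ≡ app (appSpine {n} P (const W)) W
appSpine-const-snoc {n = zero}  P W = refl
appSpine-const-snoc {n = suc n} P W = appSpine-const-snoc {n = n} (app P W) W

appSpine-lams-const : {W : Λ 0} → Value W → (M : Λ n) →
                      appSpine {n} (lams M) (const W) ↠βv subst (const W) M
appSpine-lams-const {n = zero} w M = ↠-reflexive (sym (trans (subst-cong (λ ()) M) (subst-var M)))
appSpine-lams-const {n = suc n} {W = W} w M =
  ↠-reflexive (appSpine-const-snoc {n = n} (lams (lam M)) W) ◅◅
  ↠-appˡ W (appSpine-lams-const w (lam M)) ◅◅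
  (root (βv _ W w) ◅ ↠-reflexive (exts-const-[] W M))

closedTo-id : (M : Λ 0) → closedTo M ≡ M
closedTo-id = rename-id (λ ())

-- Multi types and typing contexts

data Ty : Set

-- Multi types are finite multisets of arrow types, represented as lists up to _↭_.
Multi : Set
Multi = List Ty

data Ty where
  _⇒_ : Multi → Multi → Ty

Con : ℕ → Set
Con n = Fin n → Multi

Con-commutativeMonoid : ℕ → CommutativeMonoid 0ℓ 0ℓ
Con-commutativeMonoid n = Pointwise.commutativeMonoid (Fin n) (↭.++-commutativeMonoid {A = Ty})

module ⊕ {n : ℕ} =
  CommutativeSemigroupProperties (CommutativeMonoid.commutativeSemigroup (Con-commutativeMonoid n))

module _ {n : ℕ} where
  open CommutativeMonoid (Con-commutativeMonoid n) public
    using ()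
    renaming (_≈_ to infix 4 _≈_; _∙_ to infixl 6 _⊕_; ε to ∅;
              refl to ≈-refl; sym to ≈-sym; trans to ≈-trans; setoid to ≈-setoid;
              ∙-cong to ⊕-cong; ∙-congˡ to ⊕-congˡ; ∙-congʳ to ⊕-congʳ; comm to ⊕-comm; assoc to ⊕-assoc;
              identityˡ to ⊕-identityˡ; identityʳ to ⊕-identityʳ)
  open CommutativeMonoidSum (Con-commutativeMonoid n) public
    using ()
    renaming (sum to ∑ᶜ; sum-cong-≋ to ∑ᶜ-cong; ∑-distrib-+ to ∑ᶜ-distrib-⊕; sum-replicate-zero to ∑ᶜ-∅)

infixl 5 _▸_
_▸_ : Con n → Multi → Con (suc n)
(Γ ▸ A) zero    = A
(Γ ▸ A) (suc i) = Γ i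

▸-cong : {Γ Δ : Con n} {A B : Multi} → Γ ≈ Δ → A ↭ B → Γ ▸ A ≈ Δ ▸ B
▸-cong Γ≈Δ A↭B zero    = A↭B
▸-cong Γ≈Δ A↭B (suc i) = Γ≈Δ i

▸-⊕ : (Γ Δ : Con n) (A B : Multi) → (Γ ⊕ Δ) ▸ (A ++ B) ≈ (Γ ▸ A) ⊕ (Δ ▸ B)
▸-⊕ Γ Δ A B zero    = ↭-refl
▸-⊕ Γ Δ A B (suc i) = ↭-refl

▸-injective : {Γ Δ : Con n} {A B : Multi} → Γ ▸ A ≈ Δ ▸ B → Γ ≈ Δ × A ↭ B
▸-injective e = e ∘ suc , e zero

▸-split-weakenedʳ : {Γ : Con n} {A : Multi} {Δ₁ : Con (suc n)} {Δ₂ : Con n} →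
                    Γ ▸ A ≈ Δ₁ ⊕ (Δ₂ ▸ []) → Γ ≈ Δ₁ ∘ suc ⊕ Δ₂ × A ↭ Δ₁ zero
▸-split-weakenedʳ {Δ₁ = Δ₁} e = e ∘ suc , ↭-trans (e zero) (↭.++-identityʳ (Δ₁ zero))

▸-split-weakenedˡ : {Γ : Con n} {A : Multi} {Δ₁ : Con n} {Δ₂ : Con (suc n)} →
                    Γ ▸ A ≈ (Δ₁ ▸ []) ⊕ Δ₂ → Γ ≈ Δ₁ ⊕ Δ₂ ∘ suc × A ↭ Δ₂ zero
▸-split-weakenedˡ e = e ∘ suc , e zero

▸-η : (Γ : Con (suc n)) → Γ ≈ (Γ ∘ suc) ▸ Γ zero
▸-η Γ zero    = ↭-refl
▸-η Γ (suc i) = ↭-refl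

single : Fin n → Multi → Con n
single x A = updateAt ∅ x (const A)

single-on : (x : Fin n) (A : Multi) → single x A x ≡ A
single-on x A = updateAt-updates x ∅

single-off : {x j : Fin n} (A : Multi) → j ≢ x → single x A j ≡ []
single-off {x = x} {j} A j≢x = updateAt-minimal j x ∅ j≢x

single-⊕ : (x : Fin n) (A B : Multi) → single x (A ++ B) ≈ single x A ⊕ single x B
single-⊕ zero    A B zero    = ↭-refl
single-⊕ zero    A B (suc j) = ↭-refl
single-⊕ (suc x) A B zero    = ↭-refl
single-⊕ (suc x) A B (suc j) = single-⊕ x A B j

single-cong : (x : Fin n) {A B : Multi} → A ↭ B → single x A ≈ single x B
single-cong zero    A↭B zero    = A↭B
single-cong zero    A↭B (suc j) = ↭-refl
single-cong (suc x) A↭B zero    = ↭-refl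
single-cong (suc x) A↭B (suc j) = single-cong x A↭B j

single-[] : (x : Fin n) {A : Multi} → A ↭ [] → single x A ≈ ∅
single-[] zero    A↭[] zero    = A↭[]
single-[] zero    A↭[] (suc j) = ↭-refl
single-[] (suc x) A↭[] zero    = ↭-refl
single-[] (suc x) A↭[] (suc j) = single-[] x A↭[] j

single-zero : (A : Multi) → single {suc n} zero A ≈ ∅ ▸ A
single-zero A zero    = ↭-refl
single-zero A (suc j) = ↭-refl

single-suc : (x : Fin n) (A : Multi) → single (suc x) A ≈ single x A ▸ []
single-suc x A zero    = ↭-refl
single-suc x A (suc j) = ↭-refl

∑ᶜ-supported : (Δ : Fin k → Con n) (x : Fin k) → (∀ j → j ≢ x → Δ j ≈ ∅) → ∑ᶜ Δ ≈ Δ x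
∑ᶜ-supported {n = n} = sum-supported (CommutativeMonoid.monoid (Con-commutativeMonoid n))

∑ᶜ-▸[] : (Δ : Fin k → Con n) → ∑ᶜ (λ i → Δ i ▸ []) ≈ ∑ᶜ Δ ▸ []
∑ᶜ-▸[] {k = zero}  Δ zero    = ↭-refl
∑ᶜ-▸[] {k = zero}  Δ (suc j) = ↭-refl
∑ᶜ-▸[] {k = suc k} Δ zero    = ∑ᶜ-▸[] (Δ ∘ suc) zero
∑ᶜ-▸[] {k = suc k} Δ (suc j) = ↭.++⁺ˡ (Δ zero j) (∑ᶜ-▸[] (Δ ∘ suc) (suc j))

∑ᶜ-exts : (Δ : Fin k → Con n) (A : Multi) → single zero A ⊕ ∑ᶜ (λ i → Δ i ▸ []) ≈ ∑ᶜ Δ ▸ A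
∑ᶜ-exts Δ A = begin
  single zero A ⊕ ∑ᶜ (λ i → Δ i ▸ [])  ≈⟨ ⊕-cong (single-zero A) (∑ᶜ-▸[] Δ) ⟩
  (∅ ▸ A) ⊕ (∑ᶜ Δ ▸ [])                 ≈⟨ ▸-⊕ ∅ (∑ᶜ Δ) A [] ⟨
  ∑ᶜ Δ ▸ (A ++ [])                      ≈⟨ ▸-cong ≈-refl (↭.++-identityʳ A) ⟩
  ∑ᶜ Δ ▸ A                              ∎
  where open import Relation.Binary.Reasoning.Setoid ≈-setoid

∑ᶜ-single : (Γ : Con n) → ∑ᶜ (λ i → single i (Γ i)) ≈ Γ
∑ᶜ-single {n = zero}  Γ ()
∑ᶜ-single {n = suc n} Γ = begin
  single zero (Γ zero) ⊕ ∑ᶜ (λ i → single (suc i) (Γ (suc i)))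
    ≈⟨ ⊕-congˡ (∑ᶜ-cong (λ i → single-suc i (Γ (suc i)))) ⟩
  single zero (Γ zero) ⊕ ∑ᶜ (λ i → single i (Γ (suc i)) ▸ [])
    ≈⟨ ∑ᶜ-exts (λ i → single i (Γ (suc i))) (Γ zero) ⟩
  ∑ᶜ (λ i → single i (Γ (suc i))) ▸ Γ zero
    ≈⟨ ▸-cong (∑ᶜ-single (Γ ∘ suc)) ↭-refl ⟩
  (Γ ∘ suc) ▸ Γ zero
    ≈⟨ ▸-η Γ ⟨
  Γ ∎
  where open import Relation.Binary.Reasoning.Setoid ≈-setoid

≈single-on : ∀ {Γ : Con n} {x A} → Γ ≈ single x A → Γ x ↭ A
≈single-on {x = x} {A} e = ≡-subst (_ ↭_) (single-on x A) (e x)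

≈single-off : ∀ {Γ : Con n} {x A} → Γ ≈ single x A → ∀ j → j ≢ x → Γ j ↭ []
≈single-off {A = A} e j j≢x = ≡-subst (_ ↭_) (single-off A j≢x) (e j)

push : (Fin n → Fin m) → Con n → Con m
push ρ Γ = ∑ᶜ (λ i → single (ρ i) (Γ i))

push-cong : (ρ : Fin n → Fin m) {Γ Γ′ : Con n} → Γ ≈ Γ′ → push ρ Γ ≈ push ρ Γ′
push-cong ρ e = ∑ᶜ-cong (λ i → single-cong (ρ i) (e i))

push-⊕ : (ρ : Fin n → Fin m) (Γ₁ Γ₂ : Con n) → push ρ (Γ₁ ⊕ Γ₂) ≈ push ρ Γ₁ ⊕ push ρ Γ₂
push-⊕ ρ Γ₁ Γ₂ = ≈-trans (∑ᶜ-cong (λ i → single-⊕ (ρ i) (Γ₁ i) (Γ₂ i)))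
                         (∑ᶜ-distrib-⊕ (λ i → single (ρ i) (Γ₁ i)) (λ i → single (ρ i) (Γ₂ i)))

push-∅ : (ρ : Fin n → Fin m) → push ρ ∅ ≈ ∅
push-∅ {n} ρ = ≈-trans (∑ᶜ-cong (λ i → single-[] (ρ i) ↭-refl)) (∑ᶜ-∅ n)

push-ext : (ρ : Fin n → Fin m) (Γ : Con n) (A : Multi) → push (ext ρ) (Γ ▸ A) ≈ push ρ Γ ▸ A
push-ext ρ Γ A =
  ≈-trans (⊕-congˡ (∑ᶜ-cong (λ i → single-suc (ρ i) (Γ i)))) (∑ᶜ-exts (λ i → single (ρ i) (Γ i)) A)

push-suc : (Γ : Con n) → push suc Γ ≈ Γ ▸ []
push-suc Γ = ≈-trans (∑ᶜ-cong (λ i → single-suc i (Γ i)))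
            (≈-trans (∑ᶜ-▸[] (λ i → single i (Γ i))) (▸-cong (∑ᶜ-single Γ) ↭-refl))

push-single : (ρ : Fin n → Fin m) → ∀ {Γ : Con n} {x A} → Γ ≈ single x A → push ρ Γ ≈ single (ρ x) A
push-single ρ {Γ} {x} e =
  ≈-trans (∑ᶜ-supported _ x (λ j j≢x → single-[] (ρ j) (≈single-off e j j≢x)))
          (single-cong (ρ x) (≈single-on e))

-- The index s counts applications; it decreases strictly along βv (⊢-βv) and is unchanged
-- by σ₁ and σ₃ (⊢-σ₁, ⊢-σ₃), which makes it a termination measure for normalise.
infix 3 _⊢_∶_#_ _⊢λ_∶_#_
data _⊢_∶_#_ {n : ℕ} : Con n → Λ n → Multi → ℕ → Set
data _⊢λ_∶_#_ {n : ℕ} : Con n → Λ (suc n) → Multi → ℕ → Set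

data _⊢_∶_#_ {n} where
  var : ∀ {Γ x A} → Γ ≈ single x A → Γ ⊢ var x ∶ A # 0
  lam : ∀ {Γ M As s} → Γ ⊢λ M ∶ As # s → Γ ⊢ lam M ∶ As # s
  app : ∀ {Γ Γ₁ Γ₂ M N A B s t} → Γ ≈ Γ₁ ⊕ Γ₂ →
        Γ₁ ⊢ M ∶ (A ⇒ B) ∷ [] # s → Γ₂ ⊢ N ∶ A # t → Γ ⊢ app M N ∶ B # suc (s + t)

data _⊢λ_∶_#_ {n} where
  nil  : ∀ {Γ M} → Γ ≈ ∅ → Γ ⊢λ M ∶ [] # 0
  cons : ∀ {Γ Γ₁ Γ₂ M A B As s t} → Γ ≈ Γ₁ ⊕ Γ₂ →
         Γ₁ ▸ A ⊢ M ∶ B # s → Γ₂ ⊢λ M ∶ As # t → Γ ⊢λ M ∶ (A ⇒ B) ∷ As # (s + t)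

record Split {n : ℕ} (J₁ J₂ : Con n → ℕ → Set) (Γ : Con n) (s : ℕ) : Set where
  constructor split
  field
    {Γ₁ Γ₂} : Con n
    {s₁ s₂} : ℕ
    left    : J₁ Γ₁ s₁
    right   : J₂ Γ₂ s₂
    con-≈   : Γ ≈ Γ₁ ⊕ Γ₂
    size-≡  : s ≡ s₁ + s₂

⊢-resp-≈  : ∀ {Γ Γ′ : Con n} {M A s} → Γ ≈ Γ′ → Γ ⊢ M ∶ A # s → Γ′ ⊢ M ∶ A # s
⊢λ-resp-≈ : ∀ {Γ Γ′ : Con n} {M A s} → Γ ≈ Γ′ → Γ ⊢λ M ∶ A # s → Γ′ ⊢λ M ∶ A # s
⊢-resp-≈  Γ≈Γ′ (var e)          = var (≈-trans (≈-sym Γ≈Γ′) e)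
⊢-resp-≈  Γ≈Γ′ (lam ⊢M)         = lam (⊢λ-resp-≈ Γ≈Γ′ ⊢M)
⊢-resp-≈  Γ≈Γ′ (app e ⊢M ⊢N)    = app (≈-trans (≈-sym Γ≈Γ′) e) ⊢M ⊢N
⊢λ-resp-≈ Γ≈Γ′ (nil e)          = nil (≈-trans (≈-sym Γ≈Γ′) e)
⊢λ-resp-≈ Γ≈Γ′ (cons e ⊢M ⊢λM)  = cons (≈-trans (≈-sym Γ≈Γ′) e) ⊢M ⊢λM

⊢var⁻¹ : ∀ {Γ : Con n} {x A s} → Γ ⊢ var x ∶ A # s → Γ ≈ single x A
⊢var⁻¹ (var e) = e

⊢-resp-≡ : ∀ {Γ : Con n} {M A s s′} → s ≡ s′ → Γ ⊢ M ∶ A # s → Γ ⊢ M ∶ A # s′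
⊢-resp-≡ refl ⊢M = ⊢M

⊢λ-resp-≡ : ∀ {Γ : Con n} {M A s s′} → s ≡ s′ → Γ ⊢λ M ∶ A # s → Γ ⊢λ M ∶ A # s′
⊢λ-resp-≡ refl ⊢λM = ⊢λM

⊢λ-resp-↭ : ∀ {Γ : Con n} {M As Bs s} → Γ ⊢λ M ∶ As # s → As ↭ Bs → Γ ⊢λ M ∶ Bs # s
⊢λ-resp-↭ ⊢λM Perm.refl = ⊢λM
⊢λ-resp-↭ (cons e ⊢M ⊢λM) (prep _ p) = cons e ⊢M (⊢λ-resp-↭ ⊢λM p)
⊢λ-resp-↭ (cons {Γ₁ = Γ₁} {s = s} e ⊢M (cons {Γ₁ = Γ₃} {Γ₂ = Γ₄} {s = s′} {t = t} e′ ⊢M′ ⊢λM)) (swap _ _ p) =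
  ⊢λ-resp-≡ (+.x∙yz≈y∙xz s′ s t)
    (cons (≈-trans e (≈-trans (⊕-congˡ e′) (⊕.x∙yz≈y∙xz Γ₁ Γ₃ Γ₄))) ⊢M′ (cons ≈-refl ⊢M (⊢λ-resp-↭ ⊢λM p)))
⊢λ-resp-↭ ⊢λM (Perm.trans p q) = ⊢λ-resp-↭ (⊢λ-resp-↭ ⊢λM p) q

⊢λ-++ : ∀ {Γ₁ Γ₂ : Con n} {M As Bs s t} →
        Γ₁ ⊢λ M ∶ As # s → Γ₂ ⊢λ M ∶ Bs # t → Γ₁ ⊕ Γ₂ ⊢λ M ∶ As ++ Bs # s + t
⊢λ-++ {Γ₂ = Γ₂} (nil e) ⊢λN = ⊢λ-resp-≈ (≈-trans (≈-sym (⊕-identityˡ Γ₂)) (⊕-congʳ (≈-sym e))) ⊢λN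
⊢λ-++ {Γ₂ = Γ₂} (cons {Γ₁ = Γ₃} {Γ₂ = Γ₄} {s = s} {t = t} e ⊢M ⊢λM) ⊢λN =
  ⊢λ-resp-≡ (sym (+-assoc s t _))
    (cons (≈-trans (⊕-congʳ e) (⊕-assoc Γ₃ Γ₄ Γ₂)) ⊢M (⊢λ-++ ⊢λM ⊢λN))

⊢λ-split : ∀ {Γ : Con n} {M} As {Bs s} → Γ ⊢λ M ∶ As ++ Bs # s → Split (_⊢λ M ∶ As #_) (_⊢λ M ∶ Bs #_) Γ s
⊢λ-split []       ⊢λM = split (nil ≈-refl) ⊢λM (≈-sym (⊕-identityˡ _)) refl
⊢λ-split (_ ∷ As) (cons {Γ₁ = Γ₁} {s = s} e ⊢M ⊢λM) with ⊢λ-split As ⊢λM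
... | split {Γ₂} {Γ₃} {s₂} {s₃} ⊢λM₂ ⊢λM₃ e′ refl =
  split (cons ≈-refl ⊢M ⊢λM₂) ⊢λM₃ (≈-trans e (≈-trans (⊕-congˡ e′) (≈-sym (⊕-assoc Γ₁ Γ₂ Γ₃))))
        (sym (+-assoc s s₂ s₃))

Value⇒⊢[] : ∀ {V : Λ n} → Value V → ∅ ⊢ V ∶ [] # 0
Value⇒⊢[] (var i) = var (≈-sym (single-[] i ↭-refl))
Value⇒⊢[] (lam M) = lam (nil ≈-refl)

Value-⊢-↭ : ∀ {Γ : Con n} {V A B s} → Value V → Γ ⊢ V ∶ A # s → A ↭ B → Γ ⊢ V ∶ B # s
Value-⊢-↭ (var i) (var e) A↭B = var (≈-trans e (single-cong i A↭B))
Value-⊢-↭ (lam _) (lam ⊢λM) A↭B = lam (⊢λ-resp-↭ ⊢λM A↭B)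

Value-⊢[]⁻¹ : ∀ {Γ : Con n} {V A s} → Value V → Γ ⊢ V ∶ A # s → A ↭ [] → Γ ≈ ∅ × s ≡ 0
Value-⊢[]⁻¹ (var i) (var e) A↭[] = ≈-trans e (single-[] i A↭[]) , refl
Value-⊢[]⁻¹ (lam _) (lam ⊢λM) A↭[] with ⊢λ-resp-↭ ⊢λM A↭[]
... | nil e = e , refl

Value-⊢-split : ∀ {Γ : Con n} {V A B C s} → Value V → Γ ⊢ V ∶ C # s → C ↭ A ++ B →
                Split (_⊢ V ∶ A #_) (_⊢ V ∶ B #_) Γ s
Value-⊢-split (var i) (var e) C↭A++B =
  split (var ≈-refl) (var ≈-refl) (≈-trans e (≈-trans (single-cong i C↭A++B) (single-⊕ i _ _))) refl
Value-⊢-split {A = A} (lam _) (lam ⊢λM) C↭A++B with ⊢λ-split A (⊢λ-resp-↭ ⊢λM C↭A++B)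
... | split ⊢λM₁ ⊢λM₂ e s≡ = split (lam ⊢λM₁) (lam ⊢λM₂) e s≡

Value-⊢-++ : ∀ {Γ₁ Γ₂ : Con n} {V A B s t} → Value V →
             Γ₁ ⊢ V ∶ A # s → Γ₂ ⊢ V ∶ B # t → Γ₁ ⊕ Γ₂ ⊢ V ∶ A ++ B # s + t
Value-⊢-++ (var i) (var e) (var e′) = var (≈-trans (⊕-cong e e′) (≈-sym (single-⊕ i _ _)))
Value-⊢-++ (lam _) (lam ⊢λM) (lam ⊢λM′) = lam (⊢λ-++ ⊢λM ⊢λM′)

infix 3 _⊢_∶_ _⊢λ_∶_
_⊢_∶_ : Con n → Λ n → Multi → Set
Γ ⊢ M ∶ A = ∃[ s ] Γ ⊢ M ∶ A # s

_⊢λ_∶_ : Con n → Λ (suc n) → Multi → Set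
Γ ⊢λ M ∶ A = ∃[ s ] Γ ⊢λ M ∶ A # s

⊢-rename  : (ρ : Fin n → Fin m) → ∀ {Γ : Con n} {M A s} → Γ ⊢ M ∶ A # s → push ρ Γ ⊢ rename ρ M ∶ A # s
⊢λ-rename : (ρ : Fin n → Fin m) → ∀ {Γ : Con n} {M A s} → Γ ⊢λ M ∶ A # s →
            push ρ Γ ⊢λ rename (ext ρ) M ∶ A # s
⊢-rename ρ (var e) = var (push-single ρ e)
⊢-rename ρ (lam ⊢λM) = lam (⊢λ-rename ρ ⊢λM)
⊢-rename ρ (app {Γ₁ = Γ₁} {Γ₂} e ⊢M ⊢N) =
  app (≈-trans (push-cong ρ e) (push-⊕ ρ Γ₁ Γ₂)) (⊢-rename ρ ⊢M) (⊢-rename ρ ⊢N)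
⊢λ-rename ρ (nil e) = nil (≈-trans (push-cong ρ e) (push-∅ ρ))
⊢λ-rename ρ (cons {Γ₁ = Γ₁} {Γ₂} {A = A} e ⊢M ⊢λM) =
  cons (≈-trans (push-cong ρ e) (push-⊕ ρ Γ₁ Γ₂))
       (⊢-resp-≈ (push-ext ρ Γ₁ A) (⊢-rename (ext ρ) ⊢M)) (⊢λ-rename ρ ⊢λM)

⊢-weaken : ∀ {Γ : Con n} {M A s} → Γ ⊢ M ∶ A # s → Γ ▸ [] ⊢ weaken M ∶ A # s
⊢-weaken {Γ = Γ} ⊢M = ⊢-resp-≈ (push-suc Γ) (⊢-rename suc ⊢M)

⊢-rename⁻¹  : (ρ : Fin n → Fin m) {Θ : Con m} (M : Λ n) → ∀ {A s} → Θ ⊢ rename ρ M ∶ A # s →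
              ∃[ Γ ] Γ ⊢ M ∶ A # s × push ρ Γ ≈ Θ
⊢λ-rename⁻¹ : (ρ : Fin n → Fin m) {Θ : Con m} (M : Λ (suc n)) → ∀ {A s} → Θ ⊢λ rename (ext ρ) M ∶ A # s →
              ∃[ Γ ] Γ ⊢λ M ∶ A # s × push ρ Γ ≈ Θ
⊢-rename⁻¹ ρ (var x) (var e) = _ , var ≈-refl , ≈-trans (push-single ρ ≈-refl) (≈-sym e)
⊢-rename⁻¹ ρ (lam M) (lam ⊢λM) with ⊢λ-rename⁻¹ ρ M ⊢λM
... | Γ , ⊢λM′ , e = Γ , lam ⊢λM′ , e
⊢-rename⁻¹ ρ (app M N) (app e ⊢M ⊢N) with ⊢-rename⁻¹ ρ M ⊢M | ⊢-rename⁻¹ ρ N ⊢N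
... | Γ₁ , ⊢M′ , e₁ | Γ₂ , ⊢N′ , e₂ =
  Γ₁ ⊕ Γ₂ , app ≈-refl ⊢M′ ⊢N′ , ≈-trans (push-⊕ ρ Γ₁ Γ₂) (≈-trans (⊕-cong e₁ e₂) (≈-sym e))
⊢λ-rename⁻¹ ρ M (nil e) = ∅ , nil ≈-refl , ≈-trans (push-∅ ρ) (≈-sym e)
⊢λ-rename⁻¹ ρ M (cons {Γ₁ = Θ₁} {A = A} e ⊢M ⊢λM) with ⊢-rename⁻¹ (ext ρ) M ⊢M | ⊢λ-rename⁻¹ ρ M ⊢λM
... | Γ₁ , ⊢M′ , e₁ | Γ₂ , ⊢λM′ , e₂ =
  Γ₁ ∘ suc ⊕ Γ₂ , cons ≈-refl (⊢-resp-≈ (≈-trans (▸-η Γ₁) (▸-cong ≈-refl (proj₂ pushed))) ⊢M′) ⊢λM′ ,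
  ≈-trans (push-⊕ ρ (Γ₁ ∘ suc) Γ₂) (≈-trans (⊕-cong (proj₁ pushed) e₂) (≈-sym e))
  where
  pushed : push ρ (Γ₁ ∘ suc) ≈ Θ₁ × Γ₁ zero ↭ A
  pushed = ▸-injective (≈-trans (≈-sym (push-ext ρ (Γ₁ ∘ suc) (Γ₁ zero)))
                                (≈-trans (push-cong (ext ρ) (≈-sym (▸-η Γ₁))) e₁))

⊢-weaken⁻¹ : ∀ {Θ : Con (suc n)} (M : Λ n) → ∀ {A s} → Θ ⊢ weaken M ∶ A # s →
             ∃[ Γ ] Γ ⊢ M ∶ A # s × Θ ≈ Γ ▸ []
⊢-weaken⁻¹ M ⊢M with ⊢-rename⁻¹ suc M ⊢M
... | Γ , ⊢M′ , e = Γ , ⊢M′ , ≈-trans (≈-sym e) (push-suc Γ)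

record Typing (M : Λ m) (A : Multi) : Set where
  constructor typing
  field
    {con}  : Con m
    {size} : ℕ
    deriv  : con ⊢ M ∶ A # size
open Typing

SubstTyping : (Fin n → Λ m) → Con n → Set
SubstTyping σ Γ = ∀ i → Typing (σ i) (Γ i)

∑con : {σ : Fin n → Λ m} {Γ : Con n} → SubstTyping σ Γ → Con m
∑con τ = ∑ᶜ (con ∘ τ)

∑size : {σ : Fin n → Λ m} {Γ : Con n} → SubstTyping σ Γ → ℕ
∑size τ = ∑ℕ (size ∘ τ)

SubstTyping-split : {σ : Fin n → Λ m} {Γ Γ₁ Γ₂ : Con n} → Values σ → Γ ≈ Γ₁ ⊕ Γ₂ → (τ : SubstTyping σ Γ) →
                    Σ (SubstTyping σ Γ₁) λ τ₁ → Σ (SubstTyping σ Γ₂) λ τ₂ →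
                    ∑con τ ≈ ∑con τ₁ ⊕ ∑con τ₂ × ∑size τ ≡ ∑size τ₁ + ∑size τ₂
SubstTyping-split vσ e τ =
  (λ i → typing (Split.left (halves i))) , (λ i → typing (Split.right (halves i))) ,
  ≈-trans (∑ᶜ-cong (Split.con-≈ ∘ halves)) (∑ᶜ-distrib-⊕ (Split.Γ₁ ∘ halves) (Split.Γ₂ ∘ halves)) ,
  trans (∑ℕ-cong (Split.size-≡ ∘ halves)) (∑ℕ-distrib-+ (Split.s₁ ∘ halves) (Split.s₂ ∘ halves))
  where
  halves = λ i → Value-⊢-split (vσ i) (deriv (τ i)) (e i)

SubstTyping-⊕ : {σ : Fin n → Λ m} {Γ₁ Γ₂ : Con n} → Values σ →
                SubstTyping σ Γ₁ → SubstTyping σ Γ₂ → SubstTyping σ (Γ₁ ⊕ Γ₂)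
SubstTyping-⊕ vσ τ₁ τ₂ i = typing (Value-⊢-++ (vσ i) (deriv (τ₁ i)) (deriv (τ₂ i)))

∑con-⊕ : {σ : Fin n → Λ m} {Γ₁ Γ₂ : Con n} (vσ : Values σ) (τ₁ : SubstTyping σ Γ₁) (τ₂ : SubstTyping σ Γ₂) →
         ∑con (SubstTyping-⊕ vσ τ₁ τ₂) ≈ ∑con τ₁ ⊕ ∑con τ₂
∑con-⊕ vσ τ₁ τ₂ = ∑ᶜ-distrib-⊕ (con ∘ τ₁) (con ∘ τ₂)

SubstTyping-∅ : {σ : Fin n → Λ m} → Values σ → SubstTyping σ ∅
SubstTyping-∅ vσ i = typing (Value⇒⊢[] (vσ i))

∑con-∅ : {σ : Fin n → Λ m} (vσ : Values σ) → ∑con (SubstTyping-∅ vσ) ≈ ∅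
∑con-∅ {n} vσ = ∑ᶜ-∅ n

SubstTyping-exts : {σ : Fin n → Λ m} {Γ : Con n} → SubstTyping σ Γ → (A : Multi) →
                   SubstTyping (exts σ) (Γ ▸ A)
SubstTyping-exts τ A zero    = typing (var ≈-refl)
SubstTyping-exts τ A (suc i) = typing (⊢-weaken (deriv (τ i)))

∑con-exts : {σ : Fin n → Λ m} {Γ : Con n} (τ : SubstTyping σ Γ) (A : Multi) →
            ∑con (SubstTyping-exts τ A) ≈ ∑con τ ▸ A
∑con-exts τ A = ∑ᶜ-exts (con ∘ τ) A

SubstTyping-exts⁻¹ : {σ : Fin n → Λ m} {Γ : Con (suc n)} (τ : SubstTyping (exts σ) Γ) →
                     Σ (SubstTyping σ (Γ ∘ suc)) λ τ′ → ∑con τ ≈ ∑con τ′ ▸ Γ zero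
SubstTyping-exts⁻¹ {σ = σ} {Γ} τ = τ′ , ≈-trans (⊕-cong var-zero (∑ᶜ-cong (proj₂ ∘ proj₂ ∘ unweakened)))
                                                (∑ᶜ-exts (proj₁ ∘ unweakened) (Γ zero))
  where
  unweakened : ∀ i → ∃[ Δ ] Δ ⊢ σ i ∶ Γ (suc i) # size (τ (suc i)) × con (τ (suc i)) ≈ Δ ▸ []
  unweakened i = ⊢-weaken⁻¹ (σ i) (deriv (τ (suc i)))
  τ′ : SubstTyping σ (Γ ∘ suc)
  τ′ i = typing (proj₁ (proj₂ (unweakened i)))
  var-zero : con (τ zero) ≈ single zero (Γ zero)
  var-zero = ⊢var⁻¹ (deriv (τ zero))

⊢-subst  : {σ : Fin n → Λ m} → Values σ → ∀ {Γ M A s} → Γ ⊢ M ∶ A # s → (τ : SubstTyping σ Γ) →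
           ∃[ u ] ∑con τ ⊢ subst σ M ∶ A # u × u ≤ s + ∑size τ
⊢λ-subst : {σ : Fin n → Λ m} → Values σ → ∀ {Γ M A s} → Γ ⊢λ M ∶ A # s → (τ : SubstTyping σ Γ) →
           ∃[ u ] ∑con τ ⊢λ subst (exts σ) M ∶ A # u × u ≤ s + ∑size τ
⊢-subst vσ (var {x = x} e) τ =
  size (τ x) ,
  ⊢-resp-≈ (≈-sym (∑ᶜ-supported (con ∘ τ) x empty-elsewhere))
           (Value-⊢-↭ (vσ x) (deriv (τ x)) (≈single-on e)) ,
  ∑ℕ-≥ (size ∘ τ) x
  where
  empty-elsewhere : ∀ j → j ≢ x → con (τ j) ≈ ∅
  empty-elsewhere j j≢x = proj₁ (Value-⊢[]⁻¹ (vσ j) (deriv (τ j)) (≈single-off e j j≢x))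
⊢-subst vσ (lam ⊢λM) τ with ⊢λ-subst vσ ⊢λM τ
... | u , ⊢λM′ , u≤ = u , lam ⊢λM′ , u≤
⊢-subst vσ (app {s = s} {t = t} e ⊢M ⊢N) τ with SubstTyping-split vσ e τ
... | τ₁ , τ₂ , e′ , sizes with ⊢-subst vσ ⊢M τ₁ | ⊢-subst vσ ⊢N τ₂
... | u₁ , ⊢M′ , u₁≤ | u₂ , ⊢N′ , u₂≤ =
  suc (u₁ + u₂) , app e′ ⊢M′ ⊢N′ , s≤s (+-mono-≤-interchange s t sizes u₁≤ u₂≤)
⊢λ-subst {n} vσ (nil e) τ =
  0 , nil (≈-trans (∑ᶜ-cong (λ i → proj₁ (Value-⊢[]⁻¹ (vσ i) (deriv (τ i)) (e i)))) (∑ᶜ-∅ n)) , z≤n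
⊢λ-subst vσ (cons {A = A} {s = s} {t = t} e ⊢M ⊢λM) τ with SubstTyping-split vσ e τ
... | τ₁ , τ₂ , e′ , sizes with ⊢-subst (Values-exts vσ) ⊢M (SubstTyping-exts τ₁ A) | ⊢λ-subst vσ ⊢λM τ₂
... | u₁ , ⊢M′ , u₁≤ | u₂ , ⊢λM′ , u₂≤ =
  u₁ + u₂ , cons e′ (⊢-resp-≈ (∑con-exts τ₁ A) ⊢M′) ⊢λM′ ,
  +-mono-≤-interchange s t sizes u₁≤ u₂≤

⊢-subst⁻¹  : {σ : Fin n → Λ m} → Values σ → ∀ {Θ} (M : Λ n) → ∀ {A s} → Θ ⊢ subst σ M ∶ A # s →
             ∃[ Γ ] Γ ⊢ M ∶ A × Σ (SubstTyping σ Γ) λ τ → Θ ≈ ∑con τ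
⊢λ-subst⁻¹ : {σ : Fin n → Λ m} → Values σ → ∀ {Θ} (M : Λ (suc n)) → ∀ {A s} → Θ ⊢λ subst (exts σ) M ∶ A # s →
             ∃[ Γ ] Γ ⊢λ M ∶ A × Σ (SubstTyping σ Γ) λ τ → Θ ≈ ∑con τ
⊢-subst⁻¹ {σ = σ} vσ {Θ} (var x) {A} {s} ⊢σx =
  single x A , (0 , var ≈-refl) , τ , ≈-sym (≈-trans (∑ᶜ-supported (con ∘ τ) x empty-elsewhere) at-x)
  where
  τ : SubstTyping σ (single x A)
  τ j with j ≟ x
  ... | yes refl = typing (≡-subst (Θ ⊢ σ x ∶_# s) (sym (single-on x A)) ⊢σx)
  ... | no j≢x   = typing (≡-subst (∅ ⊢ σ j ∶_# 0) (sym (single-off A j≢x)) (Value⇒⊢[] (vσ j)))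
  empty-elsewhere : ∀ j → j ≢ x → con (τ j) ≈ ∅
  empty-elsewhere j j≢x with j ≟ x
  ... | yes j≡x = ⊥-elim (j≢x j≡x)
  ... | no _    = ≈-refl
  at-x : con (τ x) ≈ Θ
  at-x with x ≟ x
  ... | yes refl = ≈-refl
  ... | no x≢x   = ⊥-elim (x≢x refl)
⊢-subst⁻¹ vσ (lam M) (lam ⊢λM) with ⊢λ-subst⁻¹ vσ M ⊢λM
... | Γ , (_ , ⊢λM′) , τ , e = Γ , (_ , lam ⊢λM′) , τ , e
⊢-subst⁻¹ vσ (app M N) (app e ⊢M ⊢N) with ⊢-subst⁻¹ vσ M ⊢M | ⊢-subst⁻¹ vσ N ⊢N
... | Γ₁ , (_ , ⊢M′) , τ₁ , e₁ | Γ₂ , (_ , ⊢N′) , τ₂ , e₂ =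
  Γ₁ ⊕ Γ₂ , (_ , app ≈-refl ⊢M′ ⊢N′) , SubstTyping-⊕ vσ τ₁ τ₂ ,
  ≈-trans e (≈-trans (⊕-cong e₁ e₂) (≈-sym (∑con-⊕ vσ τ₁ τ₂)))
⊢λ-subst⁻¹ vσ M (nil e) = ∅ , (0 , nil ≈-refl) , SubstTyping-∅ vσ , ≈-trans e (≈-sym (∑con-∅ vσ))
⊢λ-subst⁻¹ vσ M (cons e ⊢M ⊢λM) with ⊢-subst⁻¹ (Values-exts vσ) M ⊢M | ⊢λ-subst⁻¹ vσ M ⊢λM
... | Γ₁ , (_ , ⊢M′) , τ₁ , e₁ | Γ₂ , (_ , ⊢λM′) , τ₂ , e₂ with SubstTyping-exts⁻¹ τ₁
... | τ₁′ , e₁′ with ▸-injective (≈-trans e₁ e₁′)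
... | Θ₁≈ , A↭ =
  Γ₁ ∘ suc ⊕ Γ₂ , (_ , cons ≈-refl (⊢-resp-≈ (≈-trans (▸-η Γ₁) (▸-cong ≈-refl (↭-sym A↭))) ⊢M′) ⊢λM′) ,
  SubstTyping-⊕ vσ τ₁′ τ₂ , ≈-trans e (≈-trans (⊕-cong Θ₁≈ e₂) (≈-sym (∑con-⊕ vσ τ₁′ τ₂)))

Values-sub₀ : {V : Λ n} → Value V → Values (sub₀ V)
Values-sub₀ v zero    = v
Values-sub₀ v (suc i) = var i

SubstTyping-sub₀ : ∀ {Γ Δ : Con n} {V A t} → Δ ⊢ V ∶ A # t → SubstTyping (sub₀ V) (Γ ▸ A)
SubstTyping-sub₀ ⊢V zero    = typing ⊢V
SubstTyping-sub₀ ⊢V (suc i) = typing (var ≈-refl)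

⊢-[] : ∀ {Γ Δ : Con n} {M V A B s t} → Value V → Γ ▸ A ⊢ M ∶ B # s → Δ ⊢ V ∶ A # t →
       ∃[ u ] Γ ⊕ Δ ⊢ M [ V ] ∶ B # u × u ≤ s + t
⊢-[] {n} {Γ} {Δ} {M} {V} {s = s} {t} v ⊢M ⊢V with ⊢-subst (Values-sub₀ v) ⊢M (SubstTyping-sub₀ ⊢V)
... | u , ⊢M[V] , u≤ =
  u ,
  ⊢-resp-≈ (≈-trans (⊕-congˡ (∑ᶜ-single Γ)) (⊕-comm Δ Γ))
           (≡-subst (λ N → _ ⊢ N ∶ _ # u) (sym ([]≡subst-sub₀ M V)) ⊢M[V]) ,
  ≡-subst (λ z → u ≤ s + z) (trans (cong (t +_) (∑ℕ-0 n)) (+-identityʳ t)) u≤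

⊢-[]⁻¹ : ∀ {Θ : Con n} {V B s} → Value V → (M : Λ (suc n)) → Θ ⊢ M [ V ] ∶ B # s →
         ∃[ Γ ] ∃[ A ] ∃[ Δ ] Γ ▸ A ⊢ M ∶ B × Δ ⊢ V ∶ A × Θ ≈ Γ ⊕ Δ
⊢-[]⁻¹ {V = V} v M ⊢M[V]
  with ⊢-subst⁻¹ (Values-sub₀ v) M (≡-subst (λ N → _ ⊢ N ∶ _ # _) ([]≡subst-sub₀ M V) ⊢M[V])
... | Γ , (_ , ⊢M) , τ , e =
  Γ ∘ suc , Γ zero , con (τ zero) , (_ , ⊢-resp-≈ (▸-η Γ) ⊢M) , (_ , deriv (τ zero)) ,
  ≈-trans e (≈-trans (⊕-congˡ (≈-trans (∑ᶜ-cong (⊢var⁻¹ ∘ deriv ∘ τ ∘ suc)) (∑ᶜ-single (Γ ∘ suc))))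
                     (⊕-comm (con (τ zero)) (Γ ∘ suc)))

-- Subject reduction and expansion

⊢-lam₁ : ∀ {Γ : Con n} {M A B s} → Γ ▸ A ⊢ M ∶ B # s → Γ ⊢ lam M ∶ (A ⇒ B) ∷ [] # s
⊢-lam₁ {Γ = Γ} {s = s} ⊢M = lam (⊢λ-resp-≡ (+-identityʳ s) (cons (≈-sym (⊕-identityʳ Γ)) ⊢M (nil ≈-refl)))

⊢-lam₁⁻¹ : ∀ {Γ : Con n} {M A B s} → Γ ⊢ lam M ∶ (A ⇒ B) ∷ [] # s → Γ ▸ A ⊢ M ∶ B # s
⊢-lam₁⁻¹ (lam (cons {Γ₁ = Γ₁} {s = s} e ⊢M (nil e₀))) =
  ⊢-resp-≡ (sym (+-identityʳ s))
    (⊢-resp-≈ (▸-cong (≈-sym (≈-trans e (≈-trans (⊕-congˡ e₀) (⊕-identityʳ Γ₁)))) ↭-refl) ⊢M)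

⊢-βv : ∀ {Γ : Con n} {M V B s} → Value V → Γ ⊢ app (lam M) V ∶ B # s → ∃[ u ] Γ ⊢ M [ V ] ∶ B # u × u < s
⊢-βv v (app e ⊢λM ⊢V) with ⊢-[] v (⊢-lam₁⁻¹ ⊢λM) ⊢V
... | u , ⊢M[V] , u≤ = u , ⊢-resp-≈ (≈-sym e) ⊢M[V] , s≤s u≤

⊢-σ₁ : ∀ {Θ : Con n} {M N P B s} → Θ ⊢ app (app (lam M) N) P ∶ B # s →
       Θ ⊢ app (lam (app M (weaken P))) N ∶ B # s
⊢-σ₁ (app {Γ₂ = ΓP} {t = sP} e (app {Γ₁ = Γ₁} {ΓN} {A = A} {s = sM} {t = sN} e′ ⊢λM ⊢N) ⊢P) =
  ⊢-resp-≡ (cong (2 +_) (+.xy∙z≈xz∙y sM sP sN))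
    (app (≈-trans e (≈-trans (⊕-congʳ e′) (⊕.xy∙z≈xz∙y Γ₁ ΓN ΓP)))
         (⊢-lam₁ (app (≈-trans (▸-cong ≈-refl (↭-sym (↭.++-identityʳ A))) (▸-⊕ Γ₁ ΓP A []))
                      (⊢-lam₁⁻¹ ⊢λM) (⊢-weaken ⊢P)))
         ⊢N)

⊢-σ₃ : ∀ {Θ : Con n} {V M N B s} → Θ ⊢ app V (app (lam M) N) ∶ B # s →
       Θ ⊢ app (lam (app (weaken V) M)) N ∶ B # s
⊢-σ₃ (app {Γ₁ = ΓV} {s = sV} e ⊢V (app {Γ₁ = Γ₁} {ΓN} {A = A} {s = sM} {t = sN} e′ ⊢λM ⊢N)) =
  ⊢-resp-≡ (cong suc (sym (trans (+-suc sV (sM + sN)) (cong suc (sym (+-assoc sV sM sN))))))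
    (app (≈-trans e (≈-trans (⊕-congˡ e′) (≈-sym (⊕-assoc ΓV Γ₁ ΓN))))
         (⊢-lam₁ (app (▸-⊕ ΓV Γ₁ [] A) (⊢-weaken ⊢V) (⊢-lam₁⁻¹ ⊢λM)))
         ⊢N)

⊢-βv⁻¹ : ∀ {Θ : Con n} {V B s} → Value V → (M : Λ (suc n)) → Θ ⊢ M [ V ] ∶ B # s → Θ ⊢ app (lam M) V ∶ B
⊢-βv⁻¹ v M ⊢M[V] with ⊢-[]⁻¹ v M ⊢M[V]
... | Γ , A , Δ , (_ , ⊢M) , (_ , ⊢V) , e = _ , app e (⊢-lam₁ ⊢M) ⊢V

⊢-σ₁⁻¹ : ∀ {Θ : Con n} {M N B s} (P : Λ n) → Θ ⊢ app (lam (app M (weaken P))) N ∶ B # s →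
         Θ ⊢ app (app (lam M) N) P ∶ B
⊢-σ₁⁻¹ P (app {Γ₂ = ΓN} e ⊢λ ⊢N) with ⊢-lam₁⁻¹ ⊢λ
... | app {Γ₁ = Δ} e′ ⊢M ⊢wP with ⊢-weaken⁻¹ P ⊢wP
... | ΓP , ⊢P , eP with ▸-split-weakenedʳ (≈-trans e′ (⊕-congˡ eP))
... | Γ₁≈ , A↭ =
  _ , app (≈-trans e (≈-trans (⊕-congʳ Γ₁≈) (⊕.xy∙z≈xz∙y (Δ ∘ suc) ΓP ΓN)))
          (app ≈-refl (⊢-lam₁ (⊢-resp-≈ (≈-trans (▸-η Δ) (▸-cong ≈-refl (↭-sym A↭))) ⊢M)) ⊢N)
          ⊢P

⊢-σ₃⁻¹ : ∀ {Θ : Con n} {M N B s} (V : Λ n) → Θ ⊢ app (lam (app (weaken V) M)) N ∶ B # s →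
         Θ ⊢ app V (app (lam M) N) ∶ B
⊢-σ₃⁻¹ V (app {Γ₂ = ΓN} e ⊢λ ⊢N) with ⊢-lam₁⁻¹ ⊢λ
... | app {Γ₂ = Δ} e′ ⊢wV ⊢M with ⊢-weaken⁻¹ V ⊢wV
... | ΓV , ⊢V , eV with ▸-split-weakenedˡ (≈-trans e′ (⊕-congʳ eV))
... | Γ₁≈ , A↭ =
  _ , app (≈-trans e (≈-trans (⊕-congʳ Γ₁≈) (⊕-assoc ΓV (Δ ∘ suc) ΓN)))
          ⊢V
          (app ≈-refl (⊢-lam₁ (⊢-resp-≈ (≈-trans (▸-η Δ) (▸-cong ≈-refl (↭-sym A↭))) ⊢M)) ⊢N)

⟶βv-expand : ∀ {Θ : Con n} {M M′ A s} → M ⟶βv M′ → Θ ⊢ M′ ∶ A # s → Θ ⊢ M ∶ A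
⟶βv-expand (βv M V v) = ⊢-βv⁻¹ v M

⟶root-expand : ∀ {Θ : Con n} {M M′ A s} → M ⟶root M′ → Θ ⊢ M′ ∶ A # s → Θ ⊢ M ∶ A
⟶root-expand (βv r)       = ⟶βv-expand r
⟶root-expand (σ₁ M N P)   = ⊢-σ₁⁻¹ P
⟶root-expand (σ₃ V M N v) = ⊢-σ₃⁻¹ V

module _ {R : ∀ {n} → Λ n → Λ n → Set}
         (R-expand : ∀ {n} {Θ : Con n} {M M′ A s} → R M M′ → Θ ⊢ M′ ∶ A # s → Θ ⊢ M ∶ A) where

  Ctx-expand  : ∀ {Θ : Con n} {M M′ A s} → Ctx R M M′ → Θ ⊢ M′ ∶ A # s → Θ ⊢ M ∶ A
  Ctxλ-expand : ∀ {Θ : Con n} {M M′ A s} → Ctx R M M′ → Θ ⊢λ M′ ∶ A # s → Θ ⊢λ M ∶ A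
  Ctx-expand (root r) ⊢M′ = R-expand r ⊢M′
  Ctx-expand (lam r) (lam ⊢λM′) with Ctxλ-expand r ⊢λM′
  ... | _ , ⊢λM = _ , lam ⊢λM
  Ctx-expand (appˡ P r) (app e ⊢M′ ⊢P) with Ctx-expand r ⊢M′
  ... | _ , ⊢M = _ , app e ⊢M ⊢P
  Ctx-expand (appʳ P r) (app e ⊢P ⊢M′) with Ctx-expand r ⊢M′
  ... | _ , ⊢M = _ , app e ⊢P ⊢M
  Ctxλ-expand r (nil e) = _ , nil e
  Ctxλ-expand r (cons e ⊢M′ ⊢λM′) with Ctx-expand r ⊢M′ | Ctxλ-expand r ⊢λM′
  ... | _ , ⊢M | _ , ⊢λM = _ , cons e ⊢M ⊢λM

  Star-expand : ∀ {Θ : Con n} {M M′ A} → Star (Ctx R) M M′ → Θ ⊢ M′ ∶ A → Θ ⊢ M ∶ A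
  Star-expand ε        ⊢M′ = ⊢M′
  Star-expand (r ◅ rs) ⊢M′ = Ctx-expand r (proj₂ (Star-expand rs ⊢M′))

↠βv-expand : ∀ {Θ : Con n} {M M′ A} → M ↠βv M′ → Θ ⊢ M′ ∶ A → Θ ⊢ M ∶ A
↠βv-expand = Star-expand ⟶βv-expand

↠v-expand : ∀ {Θ : Con n} {M M′ A} → M ↠v M′ → Θ ⊢ M′ ∶ A → Θ ⊢ M ∶ A
↠v-expand = Star-expand ⟶root-expand

infix 4 _⇛[_]_
data _⇛[_]_ : Multi → ℕ → Multi → Set where
  zero : ∀ {T} → T ⇛[ 0 ] T
  suc  : ∀ {A B R n} → B ⇛[ n ] R → (A ⇒ B) ∷ [] ⇛[ suc n ] R

⇛-last : ∀ {T R n} → T ⇛[ suc n ] R → ∃[ A ] T ⇛[ n ] (A ⇒ R) ∷ []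
⇛-last {n = zero}  (suc zero) = _ , zero
⇛-last {n = suc n} (suc p) with ⇛-last p
... | A , q = A , suc q

appSpine⁻¹ : ∀ {Θ : Con m} (P : Λ m) (V : Fin n → Λ m) {C s} → Θ ⊢ appSpine P V ∶ C # s →
             ∃[ Θ′ ] ∃[ T ] Θ′ ⊢ P ∶ T × T ⇛[ n ] C
appSpine⁻¹ {n = zero}  P V ⊢PV = _ , _ , (_ , ⊢PV) , zero
appSpine⁻¹ {n = suc n} P V ⊢PV with appSpine⁻¹ (app P (V zero)) (V ∘ suc) ⊢PV
... | _ , _ , (_ , app _ ⊢P _) , p = _ , _ , (_ , ⊢P) , suc p

lams⁻¹ : ∀ {Θ : Con 0} (M : Λ n) {T R s} → Θ ⊢ lams M ∶ T # s → T ⇛[ n ] R → ∃[ Γ ] Γ ⊢ M ∶ R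
lams⁻¹ {n = zero}  M ⊢M zero = _ , _ , ⊢M
lams⁻¹ {n = suc n} M ⊢M p with ⇛-last p
... | A , q with lams⁻¹ (lam M) ⊢M q
... | Γ , _ , ⊢λM = Γ ▸ A , _ , ⊢-lam₁⁻¹ ⊢λM

-- Normalisation of typed terms

-- The terms shaped like an approximant with some abstraction in place of each ⊥; these
-- are exactly the terms lying above an approximant (approximant, IsA⇒WeakA).
data WeakHead {n : ℕ} : Λ n → Set
data WeakB    {n : ℕ} : Λ n → Set
data WeakA    {n : ℕ} : Λ n → Set

data WeakHead {n} where
  base : (x : Fin n) {B : Λ n} → WeakB B → WeakHead (app (var x) B)
  more : {H A : Λ n} → WeakHead H → WeakA A → WeakHead (app H A)

data WeakB {n} where
  var  : (x : Fin n) → WeakB (var x)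
  lam  : (M : Λ (suc n)) → WeakB (lam M)
  head : {H : Λ n} → WeakHead H → WeakB H

data WeakA {n} where
  b : {M : Λ n} → WeakB M → WeakA M
  c : {M : Λ (suc n)} {H : Λ n} → WeakA M → WeakHead H → WeakA (app (lam M) H)

WeakB-value-or-head : {M : Λ n} → WeakB M → Value M ⊎ WeakHead M
WeakB-value-or-head (var x)  = inj₁ (var x)
WeakB-value-or-head (lam M)  = inj₁ (lam M)
WeakB-value-or-head (head h) = inj₂ h

record Reaches (R : Λ n → Λ n → Set) (NF : Λ n → Set) (Γ : Con n) (M : Λ n) (A : Multi) (s : ℕ) : Set where
  constructor reaches
  field
    {target} : Λ n
    steps    : Star R M target
    normal   : NF target
    {bound}  : ℕ
    bound≤   : bound ≤ s
    typed    : Γ ⊢ target ∶ A # bound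

reaches-◅◅ : ∀ {R : Λ n → Λ n → Set} {NF Γ M M′ A s s′} →
             Star R M M′ → s′ ≤ s → Reaches R NF Γ M′ A s′ → Reaches R NF Γ M A s
reaches-◅◅ r s′≤s (reaches r′ nf b≤ ⊢M) = reaches (r ◅◅ r′) nf (≤-trans b≤ s′≤s) ⊢M

Normalises : Con n → Λ n → Multi → ℕ → Set
Normalises = Reaches _→v_ WeakA

normalise       : ∀ k {Γ : Con n} {M A s} → s < k → Γ ⊢ M ∶ A # s → Normalises Γ M A s
normalise-app   : ∀ k {Γ : Con n} {P Q A s} → s ≤ k → WeakA P → WeakA Q → Γ ⊢ app P Q ∶ A # s →
                  Normalises Γ (app P Q) A s
normalise-βv    : ∀ k {Γ : Con n} {M V A s} → s ≤ k → Value V → Γ ⊢ app (lam M) V ∶ A # s →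
                  Normalises Γ (app (lam M) V) A s
normalise-σ₃    : ∀ k {Γ : Con n} {V M N A s} → s ≤ k → Value V → WeakHead N →
                  Γ ⊢ app V (app (lam M) N) ∶ A # s → Normalises Γ (app V (app (lam M) N)) A s
normalise-redex : ∀ k {Γ : Con n} {M N A s} → s ≤ k → WeakHead N → Γ ⊢ app (lam M) N ∶ A # s →
                  Normalises Γ (app (lam M) N) A s

normalise (suc k) _ (var e)    = reaches ε (b (var _)) ≤-refl (var e)
normalise (suc k) _ (lam ⊢λM) = reaches ε (b (lam _)) ≤-refl (lam ⊢λM)
normalise (suc k) (s≤s s+t<k) (app {s = s} {t = t} e ⊢P ⊢Q)
  with normalise k (<-≤-trans (s≤s (m≤m+n s t)) s+t<k) ⊢P | normalise k (<-≤-trans (s≤s (m≤n+m t s)) s+t<k) ⊢Q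
... | reaches rP wP sP≤ ⊢P′ | reaches rQ wQ sQ≤ ⊢Q′ =
  reaches-◅◅ (↠-app rP rQ) (s≤s (+-mono-≤ sP≤ sQ≤))
    (normalise-app k (≤-trans (s≤s (+-mono-≤ sP≤ sQ≤)) s+t<k) wP wQ (app e ⊢P′ ⊢Q′))

normalise-app k s≤k (b (head h))   wQ          ⊢PQ = reaches ε (b (head (more h wQ))) ≤-refl ⊢PQ
normalise-app k s≤k (b (var x))    (b w)       ⊢PQ = reaches ε (b (head (base x w))) ≤-refl ⊢PQ
normalise-app k s≤k (b (var x))    (c wM wH)   ⊢PQ = normalise-σ₃ k s≤k (var x) wH ⊢PQ
normalise-app k s≤k (b (lam M))    (c wM wH)   ⊢PQ = normalise-σ₃ k s≤k (lam M) wH ⊢PQ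
normalise-app k s≤k (b (lam M))    (b w)       ⊢PQ with WeakB-value-or-head w
... | inj₁ v = normalise-βv k s≤k v ⊢PQ
... | inj₂ h = normalise-redex k s≤k h ⊢PQ
normalise-app k s≤k (c wM wH)      wQ          ⊢PQ =
  reaches-◅◅ (root (σ₁ _ _ _) ◅ ε) ≤-refl (normalise-redex k s≤k wH (⊢-σ₁ ⊢PQ))

normalise-βv k s≤k v ⊢MV with ⊢-βv v ⊢MV
... | u , ⊢M[V] , u<s =
  reaches-◅◅ (root (βv (βv _ _ v)) ◅ ε) (<⇒≤ u<s) (normalise k (<-≤-trans u<s s≤k) ⊢M[V])

normalise-σ₃ k s≤k v wH ⊢VMN =
  reaches-◅◅ (root (σ₃ _ _ _ v) ◅ ε) ≤-refl (normalise-redex k s≤k wH (⊢-σ₃ ⊢VMN))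

normalise-redex k s≤k wH (app {s = s} {t = t} e ⊢λM ⊢N)
  with normalise k (<-≤-trans (s≤s (m≤m+n s t)) s≤k) (⊢-lam₁⁻¹ ⊢λM)
... | reaches r wM s′≤ ⊢M′ =
  reaches (↠-appˡ _ (↠-lam r)) (c wM wH) (s≤s (+-mono-≤ s′≤ ≤-refl)) (app e (⊢-lam₁ ⊢M′) ⊢N)

Evaluates : Con n → Λ n → Multi → ℕ → Set
Evaluates = Reaches (Ctx _⟶βv_) Value

evaluate : ∀ k {Γ : Con 0} {M A s} → s < k → Γ ⊢ M ∶ A # s → Evaluates Γ M A s
evaluate (suc k) _ (var {x = ()} e)
evaluate (suc k) _ (lam ⊢λM) = reaches ε (lam _) ≤-refl (lam ⊢λM)
evaluate (suc k) (s≤s s+t<k) (app {s = s} {t = t} e ⊢P ⊢Q)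
  with evaluate k (<-≤-trans (s≤s (m≤m+n s t)) s+t<k) ⊢P | evaluate k (<-≤-trans (s≤s (m≤n+m t s)) s+t<k) ⊢Q
... | reaches rP (var ()) _ _ | _
... | reaches rP (lam M) sP≤ ⊢P′ | reaches rQ v sQ≤ ⊢Q′ with ⊢-βv v (app e ⊢P′ ⊢Q′)
... | u , ⊢M[V] , u< =
  reaches-◅◅ (↠-app rP rQ ◅◅ (root (βv M _ v) ◅ ε)) (<⇒≤ u<s+t)
    (evaluate k (<-≤-trans u<s+t s+t<k) ⊢M[V])
  where u<s+t = <-≤-trans u< (s≤s (+-mono-≤ sP≤ sQ≤))

-- Approximants

approximantB    : {N : Λ n} → WeakB N    → ∃[ A ] IsB A × A ⊑ embed N
approximantHead : {N : Λ n} → WeakHead N → ∃[ A ] IsHead A × A ⊑ embed N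
approximant     : {N : Λ n} → WeakA N    → ∃[ A ] IsA A × A ⊑ embed N
approximantB (var x) = var x , var x , refl _
approximantB (lam M) = bot , bot , bot-lam _
approximantB (head h) with approximantHead h
... | A , isH , A⊑ = A , head isH , A⊑
approximantHead (base x w) with approximantB w
... | A , isB , A⊑ = app (var x) A , base x isB , app (refl _) A⊑
approximantHead (more h w) with approximantHead h | approximant w
... | A , isH , A⊑ | A′ , isA , A′⊑ = app A A′ , more isH isA , app A⊑ A′⊑
approximant (b w) with approximantB w
... | A , isB , A⊑ = A , b isB , A⊑
approximant (c w h) with approximant w | approximantHead h
... | A , isA , A⊑ | A′ , isH , A′⊑ = app (lam A) A′ , c (redex isA isH) , app (lam A⊑) A′⊑

-- ⊑ without its transitivity rule, so that it can be inverted.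
infix 4 _⊑ₛ_
data _⊑ₛ_ {n : ℕ} : Λ⊥ n → Λ⊥ n → Set where
  bot-bot : bot ⊑ₛ bot
  bot-var : (i : Fin n) → bot ⊑ₛ var i
  bot-lam : (M : Λ⊥ (suc n)) → bot ⊑ₛ lam M
  var     : (i : Fin n) → var i ⊑ₛ var i
  lam     : {M N : Λ⊥ (suc n)} → M ⊑ₛ N → lam M ⊑ₛ lam N
  app     : {M M′ N N′ : Λ⊥ n} → M ⊑ₛ M′ → N ⊑ₛ N′ → app M N ⊑ₛ app M′ N′

⊑ₛ-refl : (M : Λ⊥ n) → M ⊑ₛ M
⊑ₛ-refl (var i)   = var i
⊑ₛ-refl (lam M)   = lam (⊑ₛ-refl M)
⊑ₛ-refl (app M N) = app (⊑ₛ-refl M) (⊑ₛ-refl N)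
⊑ₛ-refl bot       = bot-bot

⊑ₛ-trans : {M N P : Λ⊥ n} → M ⊑ₛ N → N ⊑ₛ P → M ⊑ₛ P
⊑ₛ-trans bot-bot     q           = q
⊑ₛ-trans (bot-var i) (var i)     = bot-var i
⊑ₛ-trans (bot-lam M) (lam q)     = bot-lam _
⊑ₛ-trans (var i)     q           = q
⊑ₛ-trans (lam p)     (lam q)     = lam (⊑ₛ-trans p q)
⊑ₛ-trans (app p p′)  (app q q′)  = app (⊑ₛ-trans p q) (⊑ₛ-trans p′ q′)

⊑⇒⊑ₛ : {M N : Λ⊥ n} → M ⊑ N → M ⊑ₛ N
⊑⇒⊑ₛ (bot-var i)        = bot-var i
⊑⇒⊑ₛ (bot-lam M)        = bot-lam M
⊑⇒⊑ₛ (refl M)           = ⊑ₛ-refl M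
⊑⇒⊑ₛ (_⊑_.trans p q)    = ⊑ₛ-trans (⊑⇒⊑ₛ p) (⊑⇒⊑ₛ q)
⊑⇒⊑ₛ (lam p)            = lam (⊑⇒⊑ₛ p)
⊑⇒⊑ₛ (app p q)          = app (⊑⇒⊑ₛ p) (⊑⇒⊑ₛ q)

IsB⇒WeakB       : {A : Λ⊥ n} → IsB A    → {N : Λ n} → A ⊑ₛ embed N → WeakB N
IsHead⇒WeakHead : {A : Λ⊥ n} → IsHead A → {N : Λ n} → A ⊑ₛ embed N → WeakHead N
IsA⇒WeakA       : {A : Λ⊥ n} → IsA A    → {N : Λ n} → A ⊑ₛ embed N → WeakA N
IsB⇒WeakB (var x)  {var y}     _ = var y
IsB⇒WeakB (lam _)  {lam M}     _ = lam M
IsB⇒WeakB bot      {var y}     _ = var y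
IsB⇒WeakB bot      {lam M}     _ = lam M
IsB⇒WeakB (head h)             p = head (IsHead⇒WeakHead h p)
IsHead⇒WeakHead (base x isB) {app (var y) N} (app _ q) = base y (IsB⇒WeakB isB q)
IsHead⇒WeakHead (more h isA) {app M N}       (app p q) = more (IsHead⇒WeakHead h p) (IsA⇒WeakA isA q)
IsA⇒WeakA (b isB)                           p         = b (IsB⇒WeakB isB p)
IsA⇒WeakA (c (redex isA h)) {app (lam M) N} (app (lam p) q) = c (IsA⇒WeakA isA p) (IsHead⇒WeakHead h q)

-- The eater

D : Λ m
D = lam (lam (app (var (suc zero)) (var (suc zero))))

-- E W →βv D D →βv E for every value W.
E : Λ m
E = lam (app D D)

Value-E : Value {m} E
Value-E = lam _

E-eats : {W : Λ m} → Value W → app E W ↠βv E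
E-eats v = root (βv _ _ v) ◅ root (βv _ D (lam _)) ◅ ε

E-eatsB    : {N : Λ n} → WeakB N    → ∃[ W ] Value W × subst {m = m} (const E) N ↠βv W
E-eatsHead : {N : Λ n} → WeakHead N → subst {m = m} (const E) N ↠βv E
E-eatsA    : {N : Λ n} → WeakA N    → ∃[ W ] Value W × subst {m = m} (const E) N ↠βv W
E-eatsB (var x)  = E , Value-E , ε
E-eatsB (lam M)  = _ , lam _ , ε
E-eatsB (head h) = E , Value-E , E-eatsHead h
E-eatsHead (base x w) with E-eatsB w
... | W , v , r = ↠-appʳ E r ◅◅ E-eats v
E-eatsHead (more h w) with E-eatsA w
... | W , v , r = ↠-app (E-eatsHead h) r ◅◅ E-eats v
E-eatsA (b w) = E-eatsB w
E-eatsA (c {M} w h) with E-eatsA w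
... | W , v , r =
  W , v , ↠-appʳ _ (E-eatsHead h) ◅◅ (root (βv _ E Value-E) ◅ ↠-reflexive (exts-const-[] E M)) ◅◅ r

-- That the arguments Vᵢ are values is not needed in this direction.
PotentiallyValuable⇒𝒜-nonempty : (M : Λ n) → PotentiallyValuable M → 𝒜-nonempty M
PotentiallyValuable⇒𝒜-nonempty M (m , V , _ , W , spine↠W , w)
  with ↠βv-expand spine↠W (0 , Value⇒⊢[] w)
... | _ , ⊢spine with appSpine⁻¹ (closedTo (lams M)) V ⊢spine
... | _ , _ , (_ , ⊢closed) , arrows with ⊢-rename⁻¹ (λ ()) (lams M) ⊢closed
... | _ , ⊢lams , _ with lams⁻¹ M ⊢lams arrows
... | _ , s , ⊢M with normalise (suc s) ≤-refl ⊢M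
... | reaches M↠N weak _ _ with approximant weak
... | A , isA , A⊑N = A , isA , _ , M↠N , A⊑N

𝒜-nonempty⇒PotentiallyValuable : (M : Λ n) → 𝒜-nonempty M → PotentiallyValuable M
𝒜-nonempty⇒PotentiallyValuable {n} M (A , isA , N , M↠N , A⊑N)
  with E-eatsA {m = 0} (IsA⇒WeakA isA (⊑⇒⊑ₛ A⊑N))
... | W , w , N[E]↠W with ↠v-expand (subst-↠v (λ _ → Value-E) M↠N) (↠βv-expand N[E]↠W (0 , Value⇒⊢[] w))
... | s , ⊢M[E] with evaluate (suc s) ≤-refl ⊢M[E]
... | reaches M[E]↠W′ w′ _ _ =
  0 , const E , (λ _ → Value-E) , _ ,
  ↠-reflexive (cong (λ L → appSpine {n} L (const E)) (closedTo-id (lams M))) ◅◅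
    appSpine-lams-const Value-E M ◅◅ M[E]↠W′ ,
  w′

theorem4p14 : (n : ℕ) (M : Λ n) → ((i : Fin n) → i ∈FV M) →
              (PotentiallyValuable M ⇔ 𝒜-nonempty M)
theorem4p14 n M _ = mk⇔ (PotentiallyValuable⇒𝒜-nonempty M) (𝒜-nonempty⇒PotentiallyValuable M)
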